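{- Let $0\le r\le n/2$, let $B=\bigcup_{i=0}^r S(n,i)$, let $y\in B$ with $|y|=t$, and let $W_y = S^{(B)}_y \cap \left(\mathrm{span}\{S^{(B)}_z : z\in B,\ |z|<|y|\}\right)^{\perp}$ (with the span of an empty family being $\{0\}$). For $0\le i\le r$, let $W_{y,i}$ be the space of restrictions of functions in $W_y$ to $S(n,i)$. Then $W_{y,i}=\{0\}$ for $i<t$, and $W_{y,i}=V_{y,i}$ for $t\le i\le r$, where $V_{y,i}$ is the space of functions in the $t$-th eigenspace $V_t$ of $S(n,i)$ that are semi-symmetric around $y$.
   Context: Points of $\{0,1\}^n$ are identified with subsets of $\{1,\dots,n\}$; $|x|$ is Hamming weight, $|x-y|$ Hamming distance, $S(n,i)=\{x:|x|=i\}$. Orthogonal complements are with respect to the standard inner product of real functions on $B$. $S^{(B)}_z$ is the space of real functions $f$ on $B$ with $f(x)$ depending only on $(|x|,|x-z|)$. A function on $S(n,i)$ is semi-symmetric around $y$ if its value at $x$ depends only on $|x-y|$. Eigenspaces of $S(n,i)$: for $|z|\le i$ let $g_z(x)=1$ if $z\subseteq x$ and $0$ otherwise on $S(n,i)$; let $U_j=\mathrm{span}\{g_z:|z|\le j\}$; the $j$-th eigenspace is $V_0=U_0$ (constants) and $V_j=U_j\cap U_{j-1}^\perp$ for $1\le j\le i$, with the standard inner product on functions on $S(n,i)$.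
   Formalization: Functions on $B$ and on $S(n,i)$ take rational values, and spans and orthogonal complements are taken over ℚ, in place of real functions with real scalars. -}

module Defs where

open import Data.Bool using (Bool; true; false; if_then_else_; _∧_)
open import Data.Nat using (ℕ; zero; suc; _≤_; _<_; _≤?_; _≟_)
open import Data.Vec using (Vec; []; _∷_)
open import Data.List using (List; []; _∷_; _++_; map; filter; foldr)
open import Data.List.Relation.Unary.All using (All)
open import Data.Rational using (ℚ; 0ℚ; 1ℚ; _+_; _*_)
open import Data.Product using (_×_; _,_; proj₁; proj₂; ∃-syntax)
open import Relation.Binary.PropositionalEquality using (_≡_)

-- Points of {0,1}^n, identified with subsets of {1..n} (true = element present).
Point : ℕ → Set
Point n = Vec Bool n

wt : ∀ {n} → Point n → ℕ
wt [] = 0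
wt (true ∷ x) = suc (wt x)
wt (false ∷ x) = wt x

dist : ∀ {n} → Point n → Point n → ℕ
dist [] [] = 0
dist (true ∷ x) (false ∷ y) = suc (dist x y)
dist (false ∷ x) (true ∷ y) = suc (dist x y)
dist (true ∷ x) (true ∷ y) = dist x y
dist (false ∷ x) (false ∷ y) = dist x y

subsetᵇ : ∀ {n} → Point n → Point n → Bool
subsetᵇ [] [] = true
subsetᵇ (true ∷ z) (false ∷ x) = false
subsetᵇ (true ∷ z) (true ∷ x) = subsetᵇ z x
subsetᵇ (false ∷ z) (_ ∷ x) = subsetᵇ z x

allPoints : (n : ℕ) → List (Point n)
allPoints zero = [] ∷ []
allPoints (suc n) = map (false ∷_) (allPoints n) ++ map (true ∷_) (allPoints n)

-- Real-valued functions are modelled by ℚ-valued functions on all of {0,1}^n;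
-- only the values on the relevant domain (B or S(n,i)) are ever used.
Fun : ℕ → Set
Fun n = Point n → ℚ

sumℚ : List ℚ → ℚ
sumℚ = foldr _+_ 0ℚ

ipB : ∀ {n} → ℕ → Fun n → Fun n → ℚ
ipB {n} r f g = sumℚ (map (λ x → f x * g x) (filter (λ x → wt x ≤? r) (allPoints n)))

ipS : ∀ {n} → ℕ → Fun n → Fun n → ℚ
ipS {n} i f g = sumℚ (map (λ x → f x * g x) (filter (λ x → wt x ≟ i) (allPoints n)))

Pred : ℕ → Set₁
Pred n = Fun n → Set

lincomb : ∀ {n} → List (ℚ × Fun n) → Fun n
lincomb [] x = 0ℚ
lincomb ((c , g) ∷ L) x = c * g x + lincomb L x

Span : ∀ {n} → (Point n → Set) → Pred n → Pred n
Span D G f = ∃[ L ] (All (λ p → G (proj₂ p)) L × (∀ x → D x → f x ≡ lincomb L x))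

Perp : ∀ {n} → (Fun n → Fun n → ℚ) → Pred n → Pred n
Perp ip P f = ∀ g → P g → ip f g ≡ 0ℚ

InB : ∀ {n} → ℕ → Point n → Set
InB r x = wt x ≤ r

OnLevel : ∀ {n} → ℕ → Point n → Set
OnLevel i x = wt x ≡ i

SB : ∀ {n} → ℕ → Point n → Pred n
SB r z f = ∀ x x' → InB r x → InB r x' → wt x ≡ wt x' → dist x z ≡ dist x' z → f x ≡ f x'

W : ∀ {n} → ℕ → Point n → Pred n
W r y f = SB r y f ×
  Perp (ipB r) (Span (InB r) (λ g → ∃[ z ] (InB r z × wt z < wt y × SB r z g))) f

Wi : ∀ {n} → ℕ → Point n → ℕ → Pred n
Wi r y i h = ∃[ f ] (W r y f × (∀ x → OnLevel i x → h x ≡ f x))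

gfun : ∀ {n} → Point n → Fun n
gfun z x = if subsetᵇ z x then 1ℚ else 0ℚ

U : ∀ {n} → ℕ → ℕ → Pred n
U i j = Span (OnLevel i) (λ g → ∃[ z ] (wt z ≤ j × (∀ x → g x ≡ gfun z x)))

-- j-th eigenspace of S(n,i): V_0 = U_0, V_j = U_j ∩ U_{j-1}^⊥
V : ∀ {n} → ℕ → ℕ → Pred n
V i zero h = U i zero h
V i (suc j) h = U i (suc j) h × Perp (ipS i) (U i j) h

SemiSym : ∀ {n} → ℕ → Point n → Pred n
SemiSym i y h = ∀ x x' → OnLevel i x → OnLevel i x' → dist x y ≡ dist x' y → h x ≡ h x'

Vyi : ∀ {n} → Point n → ℕ → Pred n
Vyi y i h = V i (wt y) h × SemiSym i y h

SameOn : ∀ {n} → ℕ → Pred n → Pred n → Set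
SameOn i P Q = (∀ h → P h → Q h) × (∀ h → Q h → P h)

ZeroOn : ∀ {n} → ℕ → Pred n
ZeroOn i h = ∀ x → OnLevel i x → h x ≡ 0ℚ

{-# OPTIONS --safe #-}
-- On a level S(n,i) ⊆ B, a function semi-symmetric around z depends only on x ∩ z, and
-- Möbius inversion over the subsets of z writes it as a combination of the g_w with
-- |w| ≤ |z|; conversely g_w itself is semi-symmetric around w. Since the inner product on B
-- of a function supported on S(n,i) is its inner product on S(n,i), orthogonality to every
-- S^(B)_z with |z| < t becomes, level by level, orthogonality to U_{t-1}: this identifies
-- W_{y,i} with V_{y,i}. For i < t the point mass at x ∈ S(n,i) lies in S^(B)_x, so every
-- element of W_y vanishes on S(n,i).
module Submission where

open import Defs
open import Data.Bool using (Bool; true; false; if_then_else_; _∧_; _∨_; T)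
open import Data.Bool.Properties using (∧-zeroʳ; T-∨)
open import Data.Empty using (⊥-elim)
open import Data.List using (List; []; _∷_; _++_; map; filter)
open import Data.List.Relation.Unary.All using (All; []; _∷_)
import Data.List.Relation.Unary.All as All
open import Data.List.Relation.Unary.All.Properties using (++⁺; map⁺)
open import Data.Nat using (ℕ; zero; suc; _+_; _*_; _≤_; _<_; _≤?_; _≟_; _≡ᵇ_; z≤n; s≤s)
open import Data.Nat.Properties
  using (+-suc; +-cancelʳ-≡; ≤-trans; ≤-reflexive; <-≤-trans; <⇒≤; <⇒≢; m≤n⇒m≤1+n; ≡⇒≡ᵇ; ≡ᵇ⇒≡)
open import Data.Sum using (inj₁; inj₂)
open import Data.Product using (_×_; _,_; proj₁; proj₂; ∃-syntax; map₁)
open import Data.Rational using (ℚ; 0ℚ; 1ℚ; -_) renaming (_+_ to _+ℚ_; _*_ to _·_)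
open import Data.Rational.Properties
  using (+-identityˡ; +-identityʳ; +-assoc; *-zeroˡ; *-zeroʳ; *-identityˡ; *-identityʳ; *-comm)
open import Data.Rational.Solver using (module +-*-Solver)
open import Data.Vec using ([]; _∷_; zipWith)
open import Data.Vec.Properties using (∷-injectiveʳ)
open import Function.Base using (_∘_)
open import Function.Bundles using (Equivalence)
open import Relation.Binary.PropositionalEquality
open import Relation.Nullary using (yes; no; does)
open import Relation.Nullary.Decidable using (dec-true; dec-false)
open import Relation.Unary using (Decidable)

_∩_ : ∀ {n} → Point n → Point n → Point n
_∩_ = zipWith _∧_

dist+2wt∩ : ∀ {n} (x z : Point n) → dist x z + (wt (x ∩ z) + wt (x ∩ z)) ≡ wt x + wt z
dist+2wt∩ [] [] = refl
dist+2wt∩ (true ∷ x) (true ∷ z) = begin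
  dist x z + (suc m + suc m)    ≡⟨ +-suc (dist x z) (m + suc m) ⟩
  suc (dist x z + (m + suc m))  ≡⟨ cong (λ k → suc (dist x z + k)) (+-suc m m) ⟩
  suc (dist x z + suc (m + m))  ≡⟨ cong suc (+-suc (dist x z) (m + m)) ⟩
  suc (suc (dist x z + (m + m))) ≡⟨ cong (λ k → suc (suc k)) (dist+2wt∩ x z) ⟩
  suc (suc (wt x + wt z))       ≡⟨ cong suc (+-suc (wt x) (wt z)) ⟨
  suc (wt x + suc (wt z))       ∎
  where open ≡-Reasoning
        m : ℕ
        m = wt (x ∩ z)
dist+2wt∩ (true ∷ x) (false ∷ z) = cong suc (dist+2wt∩ x z)
dist+2wt∩ (false ∷ x) (true ∷ z) = trans (cong suc (dist+2wt∩ x z)) (sym (+-suc (wt x) (wt z)))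
dist+2wt∩ (false ∷ x) (false ∷ z) = dist+2wt∩ x z

∩-determines-dist : ∀ {n} {x x' : Point n} (z : Point n) →
  wt x ≡ wt x' → x ∩ z ≡ x' ∩ z → dist x z ≡ dist x' z
∩-determines-dist {x = x} {x'} z wx≡wx' x∩z≡x'∩z = +-cancelʳ-≡ _ (dist x z) (dist x' z) (begin
  dist x z + (wt (x ∩ z) + wt (x ∩ z))     ≡⟨ dist+2wt∩ x z ⟩
  wt x + wt z                              ≡⟨ cong (_+ wt z) wx≡wx' ⟩
  wt x' + wt z                             ≡⟨ dist+2wt∩ x' z ⟨
  dist x' z + (wt (x' ∩ z) + wt (x' ∩ z))  ≡⟨ cong (λ m → dist x' z + (wt m + wt m)) x∩z≡x'∩z ⟨
  dist x' z + (wt (x ∩ z) + wt (x ∩ z))    ∎)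
  where open ≡-Reasoning

dist-refl : ∀ {n} (x : Point n) → dist x x ≡ 0
dist-refl [] = refl
dist-refl (true ∷ x) = dist-refl x
dist-refl (false ∷ x) = dist-refl x

dist≡0⇒≡ : ∀ {n} {x y : Point n} → dist x y ≡ 0 → x ≡ y
dist≡0⇒≡ {x = []} {[]} _ = refl
dist≡0⇒≡ {x = true ∷ x} {true ∷ y} d≡0 = cong (true ∷_) (dist≡0⇒≡ d≡0)
dist≡0⇒≡ {x = false ∷ x} {false ∷ y} d≡0 = cong (false ∷_) (dist≡0⇒≡ d≡0)

wt≤dist+wt : ∀ {n} (x w : Point n) → wt x ≤ dist x w + wt w
wt≤dist+wt [] [] = z≤n
wt≤dist+wt (true ∷ x) (true ∷ w) = ≤-trans (s≤s (wt≤dist+wt x w)) (≤-reflexive (sym (+-suc _ _)))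
wt≤dist+wt (true ∷ x) (false ∷ w) = s≤s (wt≤dist+wt x w)
wt≤dist+wt (false ∷ x) (true ∷ w) =
  ≤-trans (m≤n⇒m≤1+n (m≤n⇒m≤1+n (wt≤dist+wt x w))) (≤-reflexive (cong suc (sym (+-suc _ _))))
wt≤dist+wt (false ∷ x) (false ∷ w) = wt≤dist+wt x w

subsetᵇ-by-dist : ∀ {n} (w x : Point n) → subsetᵇ w x ≡ (dist x w + wt w ≡ᵇ wt x)
subsetᵇ-by-dist [] [] = refl
subsetᵇ-by-dist (true ∷ w) (true ∷ x) rewrite +-suc (dist x w) (wt w) = subsetᵇ-by-dist w x
subsetᵇ-by-dist (true ∷ w) (false ∷ x) =
  -- does (m ≟ n) computes to m ≡ᵇ n
  sym (dec-false (_ ≟ wt x) (λ eq → <⇒≢ x<d+w+2 (sym eq)))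
  where x<d+w+2 : wt x < suc (dist x w) + suc (wt w)
        x<d+w+2 = ≤-trans (s≤s (m≤n⇒m≤1+n (wt≤dist+wt x w))) (≤-reflexive (cong suc (sym (+-suc _ _))))
subsetᵇ-by-dist (false ∷ w) (true ∷ x) = subsetᵇ-by-dist w x
subsetᵇ-by-dist (false ∷ w) (false ∷ x) = subsetᵇ-by-dist w x

gfun-by-dist : ∀ {n} (w : Point n) {x x' : Point n} →
  wt x ≡ wt x' → dist x w ≡ dist x' w → gfun w x ≡ gfun w x'
gfun-by-dist w {x} {x'} wx≡wx' dx≡dx' = cong (λ b → if b then 1ℚ else 0ℚ) (begin
  subsetᵇ w x                    ≡⟨ subsetᵇ-by-dist w x ⟩
  (dist x w + wt w ≡ᵇ wt x)      ≡⟨ cong₂ (λ d k → d + wt w ≡ᵇ k) dx≡dx' wx≡wx' ⟩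
  (dist x' w + wt w ≡ᵇ wt x')    ≡⟨ subsetᵇ-by-dist w x' ⟨
  subsetᵇ w x'                   ∎)
  where open ≡-Reasoning

sumOf : {A : Set} → List A → (A → ℚ) → ℚ
sumOf xs φ = sumℚ (map φ xs)

sumOf-zero : {A : Set} (xs : List A) {φ : A → ℚ} → (∀ x → φ x ≡ 0ℚ) → sumOf xs φ ≡ 0ℚ
sumOf-zero [] _ = refl
sumOf-zero (x ∷ xs) φ≡0 = trans (cong₂ _+ℚ_ (φ≡0 x) (sumOf-zero xs φ≡0)) (+-identityˡ 0ℚ)

sumOf-cong : {A : Set} (xs : List A) {φ ψ : A → ℚ} → (∀ x → φ x ≡ ψ x) → sumOf xs φ ≡ sumOf xs ψ
sumOf-cong [] _ = refl
sumOf-cong (x ∷ xs) φ≡ψ = cong₂ _+ℚ_ (φ≡ψ x) (sumOf-cong xs φ≡ψ)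

sumOf-filter-cong : {A : Set} {P : A → Set} (P? : Decidable P) (xs : List A) {φ ψ : A → ℚ} →
  (∀ x → P x → φ x ≡ ψ x) → sumOf (filter P? xs) φ ≡ sumOf (filter P? xs) ψ
sumOf-filter-cong P? [] _ = refl
sumOf-filter-cong P? (x ∷ xs) φ≡ψ with P? x
... | yes Px = cong₂ _+ℚ_ (φ≡ψ x Px) (sumOf-filter-cong P? xs φ≡ψ)
... | no _ = sumOf-filter-cong P? xs φ≡ψ

if-then-0 : ∀ b {u : ℚ} → u ≡ 0ℚ → (if b then u else 0ℚ) ≡ 0ℚ
if-then-0 true u≡0 = u≡0
if-then-0 false _ = refl

sumOf-filter : {A : Set} {P : A → Set} (P? : Decidable P) (xs : List A) (φ : A → ℚ) →
  sumOf (filter P? xs) φ ≡ sumOf xs (λ x → if does (P? x) then φ x else 0ℚ)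
sumOf-filter P? [] φ = refl
sumOf-filter P? (x ∷ xs) φ with P? x
... | yes _ = cong (φ x +ℚ_) (sumOf-filter P? xs φ)
... | no _ = trans (sumOf-filter P? xs φ) (sym (+-identityˡ _))

sumOf-++ : {A : Set} (xs ys : List A) (φ : A → ℚ) → sumOf (xs ++ ys) φ ≡ sumOf xs φ +ℚ sumOf ys φ
sumOf-++ [] ys φ = sym (+-identityˡ _)
sumOf-++ (x ∷ xs) ys φ = trans (cong (φ x +ℚ_) (sumOf-++ xs ys φ)) (sym (+-assoc (φ x) _ _))

sumOf-map : {A B : Set} (g : A → B) (xs : List A) (φ : B → ℚ) → sumOf (map g xs) φ ≡ sumOf xs (λ x → φ (g x))
sumOf-map g [] φ = refl
sumOf-map g (x ∷ xs) φ = cong (φ (g x) +ℚ_) (sumOf-map g xs φ)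

sumOf-linearʳ : {A : Set} (xs : List A) (f g k : A → ℚ) (c : ℚ) →
  sumOf xs (λ x → f x · (c · g x +ℚ k x)) ≡ c · sumOf xs (λ x → f x · g x) +ℚ sumOf xs (λ x → f x · k x)
sumOf-linearʳ [] f g k c = solve 1 (λ c → con 0ℚ := c :* con 0ℚ :+ con 0ℚ) refl c
  where open +-*-Solver
sumOf-linearʳ (x ∷ xs) f g k c rewrite sumOf-linearʳ xs f g k c =
  solve 6 (λ a b d c s t → a :* (c :* b :+ d) :+ (c :* s :+ t) := c :* (a :* b :+ s) :+ (a :* d :+ t))
    refl (f x) (g x) (k x) c (sumOf xs (λ x → f x · g x)) (sumOf xs (λ x → f x · k x))
  where open +-*-Solver

sumOf-allPoints-suc : ∀ n (φ : Point (suc n) → ℚ) →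
  sumOf (allPoints (suc n)) φ
    ≡ sumOf (allPoints n) (λ x → φ (false ∷ x)) +ℚ sumOf (allPoints n) (λ x → φ (true ∷ x))
sumOf-allPoints-suc n φ =
  trans (sumOf-++ (map (false ∷_) (allPoints n)) _ φ)
        (cong₂ _+ℚ_ (sumOf-map (false ∷_) (allPoints n) φ) (sumOf-map (true ∷_) (allPoints n) φ))

sumOf-allPoints-single : ∀ n (x : Point n) (φ : Point n → ℚ) →
  (∀ w → w ≢ x → φ w ≡ 0ℚ) → sumOf (allPoints n) φ ≡ φ x
sumOf-allPoints-single zero [] φ _ = +-identityʳ (φ [])
sumOf-allPoints-single (suc n) (false ∷ x) φ φ≡0 = begin
  sumOf (allPoints (suc n)) φ  ≡⟨ sumOf-allPoints-suc n φ ⟩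
  _                            ≡⟨ cong₂ _+ℚ_
                                    (sumOf-allPoints-single n x _ (λ w w≢x → φ≡0 _ (w≢x ∘ ∷-injectiveʳ)))
                                    (sumOf-zero (allPoints n) (λ w → φ≡0 _ (λ ()))) ⟩
  φ (false ∷ x) +ℚ 0ℚ          ≡⟨ +-identityʳ _ ⟩
  φ (false ∷ x)                ∎
  where open ≡-Reasoning
sumOf-allPoints-single (suc n) (true ∷ x) φ φ≡0 = begin
  sumOf (allPoints (suc n)) φ  ≡⟨ sumOf-allPoints-suc n φ ⟩
  _                            ≡⟨ cong₂ _+ℚ_
                                    (sumOf-zero (allPoints n) (λ w → φ≡0 _ (λ ())))
                                    (sumOf-allPoints-single n x _ (λ w w≢x → φ≡0 _ (w≢x ∘ ∷-injectiveʳ))) ⟩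
  0ℚ +ℚ φ (true ∷ x)           ≡⟨ +-identityˡ _ ⟩
  φ (true ∷ x)                 ∎
  where open ≡-Reasoning

ipOn : ∀ {n} {P : Point n → Set} → Decidable P → Fun n → Fun n → ℚ
ipOn {n} P? f g = sumOf (filter P? (allPoints n)) (λ x → f x · g x)

ipOn-cong : ∀ {n} {P : Point n → Set} (P? : Decidable P) {f f' g g' : Fun n} →
  (∀ x → P x → f x ≡ f' x) → (∀ x → P x → g x ≡ g' x) → ipOn P? f g ≡ ipOn P? f' g'
ipOn-cong {n} P? f≡f' g≡g' =
  sumOf-filter-cong P? (allPoints n) (λ x Px → cong₂ _·_ (f≡f' x Px) (g≡g' x Px))

ipOn-comm : ∀ {n} {P : Point n → Set} (P? : Decidable P) (f g : Fun n) → ipOn P? f g ≡ ipOn P? g f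
ipOn-comm {n} P? f g = sumOf-cong (filter P? (allPoints n)) (λ x → *-comm (f x) (g x))

ipOn-lincomb : ∀ {n} {P : Point n → Set} (P? : Decidable P) (f : Fun n) (L : List (ℚ × Fun n)) →
  All (λ p → ipOn P? f (proj₂ p) ≡ 0ℚ) L → ipOn P? f (lincomb L) ≡ 0ℚ
ipOn-lincomb {n} P? f [] [] = sumOf-zero (filter P? (allPoints n)) (λ x → *-zeroʳ (f x))
ipOn-lincomb {n} P? f ((c , g) ∷ L) (f⊥g ∷ f⊥L) = begin
  ipOn P? f (lincomb ((c , g) ∷ L))
    ≡⟨ sumOf-linearʳ (filter P? (allPoints n)) f g (lincomb L) c ⟩
  c · ipOn P? f g +ℚ ipOn P? f (lincomb L)
    ≡⟨ cong₂ (λ a b → c · a +ℚ b) f⊥g (ipOn-lincomb P? f L f⊥L) ⟩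
  c · 0ℚ +ℚ 0ℚ
    ≡⟨ trans (+-identityʳ _) (*-zeroʳ c) ⟩
  0ℚ ∎
  where open ≡-Reasoning

generator∈Span : ∀ {n} {D : Point n → Set} {G : Pred n} {g : Fun n} → G g → Span D G g
generator∈Span {g = g} Gg =
  ((1ℚ , g) ∷ []) , (Gg ∷ []) , λ x _ → sym (trans (+-identityʳ _) (*-identityˡ (g x)))

⊥generators⇒⊥Span : ∀ {n} {P : Point n → Set} (P? : Decidable P) {G : Pred n} {f : Fun n} →
  (∀ g → G g → ipOn P? f g ≡ 0ℚ) → Perp (ipOn P?) (Span P G) f
⊥generators⇒⊥Span P? {f = f} f⊥G g (L , L⊆G , g≡L) =
  trans (ipOn-cong P? {f} (λ _ _ → refl) g≡L) (ipOn-lincomb P? f L (All.map (f⊥G _) L⊆G))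

-- The point mass at x, written through dist so that it is visibly semi-symmetric around x.
δ : ∀ {n} → Point n → Fun n
δ x w = if dist w x ≡ᵇ 0 then 1ℚ else 0ℚ

δ-off : ∀ {n} {x w : Point n} → w ≢ x → δ x w ≡ 0ℚ
δ-off {x = x} {w} w≢x with dist w x in eq
... | zero = ⊥-elim (w≢x (dist≡0⇒≡ eq))
... | suc _ = refl

δ-on : ∀ {n} (x : Point n) → δ x x ≡ 1ℚ
δ-on x rewrite dist-refl x = refl

ipOn-δ : ∀ {n} {P : Point n → Set} (P? : Decidable P) (f : Fun n) {x : Point n} → P x → ipOn P? f (δ x) ≡ f x
ipOn-δ {n} P? f {x} Px = begin
  ipOn P? f (δ x)
    ≡⟨ sumOf-filter P? (allPoints n) _ ⟩
  sumOf (allPoints n) (λ w → if does (P? w) then f w · δ x w else 0ℚ)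
    ≡⟨ sumOf-allPoints-single n x _ off ⟩
  (if does (P? x) then f x · δ x x else 0ℚ)
    ≡⟨ cong (λ b → if b then f x · δ x x else 0ℚ) (dec-true (P? x) Px) ⟩
  f x · δ x x
    ≡⟨ trans (cong (f x ·_) (δ-on x)) (*-identityʳ (f x)) ⟩
  f x ∎
  where
  open ≡-Reasoning
  off : ∀ w → w ≢ x → (if does (P? w) then f w · δ x w else 0ℚ) ≡ 0ℚ
  off w w≢x = if-then-0 (does (P? w)) (trans (cong (f w ·_) (δ-off w≢x)) (*-zeroʳ (f w)))

level⊆B : ∀ {n r i} {x : Point n} → i ≤ r → wt x ≡ i → InB r x
level⊆B i≤r wx≡i = subst (_≤ _) (sym wx≡i) i≤r

restrict : ∀ {n} → ℕ → Fun n → Fun n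
restrict i g x = if does (wt x ≟ i) then g x else 0ℚ

restrict-on : ∀ {n} {i} (g : Fun n) {x : Point n} → wt x ≡ i → restrict i g x ≡ g x
restrict-on {i = i} g {x} wx≡i = cong (λ b → if b then g x else 0ℚ) (dec-true (wt x ≟ i) wx≡i)

restrict-off : ∀ {n} {i} (g : Fun n) {x : Point n} → wt x ≢ i → restrict i g x ≡ 0ℚ
restrict-off {i = i} g {x} wx≢i = cong (λ b → if b then g x else 0ℚ) (dec-false (wt x ≟ i) wx≢i)

ipB-restrictˡ : ∀ {n r i} → i ≤ r → (f g : Fun n) → ipB r (restrict i f) g ≡ ipS i f g
ipB-restrictˡ {n} {r} {i} i≤r f g =
  trans (sumOf-filter (λ x → wt x ≤? r) (allPoints n) _)
        (trans (sumOf-cong (allPoints n) pointwise) (sym (sumOf-filter (λ x → wt x ≟ i) (allPoints n) _)))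
  where
  pointwise : ∀ x → (if does (wt x ≤? r) then restrict i f x · g x else 0ℚ)
                  ≡ (if does (wt x ≟ i) then f x · g x else 0ℚ)
  pointwise x with wt x ≟ i
  ... | yes wx≡i = begin
    (if does (wt x ≤? r) then restrict i f x · g x else 0ℚ)
      ≡⟨ cong (λ b → if b then restrict i f x · g x else 0ℚ)
              (dec-true (wt x ≤? r) (level⊆B {x = x} i≤r wx≡i)) ⟩
    restrict i f x · g x
      ≡⟨ cong (_· g x) (restrict-on f {x} wx≡i) ⟩
    f x · g x
      ≡⟨ cong (λ b → if b then f x · g x else 0ℚ) (dec-true (wt x ≟ i) wx≡i) ⟨
    (if does (wt x ≟ i) then f x · g x else 0ℚ) ∎
    where open ≡-Reasoning
  ... | no wx≢i = begin
    (if does (wt x ≤? r) then restrict i f x · g x else 0ℚ)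
      ≡⟨ if-then-0 (does (wt x ≤? r)) (trans (cong (_· g x) (restrict-off f {x} wx≢i)) (*-zeroˡ (g x))) ⟩
    0ℚ
      ≡⟨ cong (λ b → if b then f x · g x else 0ℚ) (dec-false (wt x ≟ i) wx≢i) ⟨
    (if does (wt x ≟ i) then f x · g x else 0ℚ) ∎
    where open ≡-Reasoning

ipB-restrictʳ : ∀ {n r i} → i ≤ r → (f g : Fun n) → ipB r f (restrict i g) ≡ ipS i f g
ipB-restrictʳ {r = r} {i} i≤r f g = begin
  ipB r f (restrict i g)  ≡⟨ ipOn-comm (λ x → wt x ≤? r) f (restrict i g) ⟩
  ipB r (restrict i g) f  ≡⟨ ipB-restrictˡ i≤r g f ⟩
  ipS i g f               ≡⟨ ipOn-comm (λ x → wt x ≟ i) g f ⟩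
  ipS i f g               ∎
  where open ≡-Reasoning

-- Möbius inversion over the subsets of z

gcomb : ∀ {n} → List (ℚ × Point n) → Fun n
gcomb K = lincomb (map (λ (c , w) → c , gfun w) K)

gcomb-++ : ∀ {n} (K K' : List (ℚ × Point n)) x → gcomb (K ++ K') x ≡ gcomb K x +ℚ gcomb K' x
gcomb-++ [] K' x = sym (+-identityˡ _)
gcomb-++ ((c , w) ∷ K) K' x =
  trans (cong (c · gfun w x +ℚ_) (gcomb-++ K K' x)) (sym (+-assoc (c · gfun w x) _ _))

gcomb-neg : ∀ {n} (K : List (ℚ × Point n)) x → gcomb (map (map₁ -_) K) x ≡ - gcomb K x
gcomb-neg [] x = refl
gcomb-neg ((c , w) ∷ K) x rewrite gcomb-neg K x =
  solve 3 (λ c g s → (:- c) :* g :+ (:- s) := :- (c :* g :+ s)) refl c (gfun w x) (gcomb K x)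
  where open +-*-Solver

extend : ∀ {n} → Bool → ℚ × Point n → ℚ × Point (suc n)
extend b (c , w) = c , b ∷ w

gcomb-extend-false : ∀ {n} (K : List (ℚ × Point n)) b x →
  gcomb (map (extend false) K) (b ∷ x) ≡ gcomb K x
gcomb-extend-false [] b x = refl
gcomb-extend-false ((c , w) ∷ K) b x = cong (c · gfun w x +ℚ_) (gcomb-extend-false K b x)

gcomb-extend-true-at-true : ∀ {n} (K : List (ℚ × Point n)) x →
  gcomb (map (extend true) K) (true ∷ x) ≡ gcomb K x
gcomb-extend-true-at-true [] x = refl
gcomb-extend-true-at-true ((c , w) ∷ K) x = cong (c · gfun w x +ℚ_) (gcomb-extend-true-at-true K x)

gcomb-extend-true-at-false : ∀ {n} (K : List (ℚ × Point n)) x →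
  gcomb (map (extend true) K) (false ∷ x) ≡ 0ℚ
gcomb-extend-true-at-false [] x = refl
gcomb-extend-true-at-false ((c , w) ∷ K) x =
  trans (cong (c · 0ℚ +ℚ_) (gcomb-extend-true-at-false K x)) (trans (+-identityʳ _) (*-zeroʳ c))

-- The domain is a set of weights rather than a single level because the induction on z
-- moves between adjacent levels.
MeetInvariantOn : ∀ {n} → (ℕ → Bool) → Point n → Fun n → Set
MeetInvariantOn D z F = ∀ x x' → T (D (wt x)) → T (D (wt x')) → x ∩ z ≡ x' ∩ z → F x ≡ F x'

GcombOn : ∀ {n} → (ℕ → Bool) → ℕ → Fun n → Set
GcombOn {n} D j F =
  ∃[ K ] (All (λ p → wt (proj₂ p) ≤ j) K × (∀ (x : Point n) → T (D (wt x)) → F x ≡ gcomb K x))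

tailDomain : (ℕ → Bool) → ℕ → Bool
tailDomain D k = D k ∨ D (suc k)

T-tailDomain : ∀ (D : ℕ → Bool) b {n} (x : Point n) → T (D (wt (b ∷ x))) → T (tailDomain D (wt x))
T-tailDomain D false x Dx = Equivalence.from T-∨ (inj₁ Dx)
T-tailDomain D true x Dx = Equivalence.from T-∨ (inj₂ Dx)

meetInvariant-factor-tail : ∀ {n} (D : ℕ → Bool) (z : Point n) (F : Fun (suc n)) →
  MeetInvariantOn D (false ∷ z) F →
  ∃[ G ] (MeetInvariantOn (tailDomain D) z G × (∀ b x → T (D (wt (b ∷ x))) → F (b ∷ x) ≡ G x))
meetInvariant-factor-tail {n} D z F inv = G , invG , F≡G
  where
  -- F at whichever of false ∷ x, true ∷ x lies in the domain; they agree when both do.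
  G : Fun n
  G x = if D (wt x) then F (false ∷ x) else F (true ∷ x)

  pick : ∀ x → T (tailDomain D (wt x)) → ∃[ b ] (T (D (wt (b ∷ x))) × G x ≡ F (b ∷ x))
  pick x D'x with D (wt x) in eq
  ... | true = false , subst T (sym eq) _ , refl
  ... | false = true , D'x , refl

  invG : MeetInvariantOn (tailDomain D) z G
  invG x x' D'x D'x' x∩z≡x'∩z with pick x D'x | pick x' D'x'
  ... | b , Db , Gx≡ | b' , Db' , Gx'≡ = begin
    G x           ≡⟨ Gx≡ ⟩
    F (b ∷ x)     ≡⟨ inv (b ∷ x) (b' ∷ x') Db Db' (cong₂ _∷_ (trans (∧-zeroʳ b) (sym (∧-zeroʳ b'))) x∩z≡x'∩z) ⟩
    F (b' ∷ x')   ≡⟨ Gx'≡ ⟨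
    G x'          ∎
    where open ≡-Reasoning

  F≡G : ∀ b x → T (D (wt (b ∷ x))) → F (b ∷ x) ≡ G x
  F≡G false x Dx with D (wt x)
  ... | true = refl
  ... | false = ⊥-elim Dx
  F≡G true x Dx with D (wt x) in eq
  ... | true = inv (true ∷ x) (false ∷ x) Dx (subst T (sym eq) _) refl
  ... | false = refl

meetInvariant⇒gcomb : ∀ {n} (D : ℕ → Bool) (z : Point n) (F : Fun n) →
  MeetInvariantOn D z F → GcombOn D (wt z) F
meetInvariant⇒gcomb D [] F _ =
  ((F [] , []) ∷ []) , (z≤n ∷ []) , λ { [] _ → sym (trans (+-identityʳ _) (*-identityʳ (F []))) }
meetInvariant⇒gcomb D (false ∷ z) F inv with meetInvariant-factor-tail D z F inv
... | G , invG , F≡G with meetInvariant⇒gcomb (tailDomain D) z G invG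
...   | K , K≤ , G≡K = map (extend false) K , map⁺ K≤ , λ where
  (b ∷ x) Dx → trans (F≡G b x Dx) (trans (G≡K x (T-tailDomain D b x Dx)) (sym (gcomb-extend-false K b x)))
meetInvariant⇒gcomb {suc n} D (true ∷ z) F inv
  with meetInvariant⇒gcomb D z (λ x → F (false ∷ x)) (λ _ _ Dx Dx' eq → inv _ _ Dx Dx' (cong (false ∷_) eq))
     | meetInvariant⇒gcomb (D ∘ suc) z (λ x → F (true ∷ x)) (λ _ _ Dx Dx' eq → inv _ _ Dx Dx' (cong (true ∷_) eq))
... | K₀ , K₀≤ , F₀≡K₀ | K₁ , K₁≤ , F₁≡K₁ =
  K , ++⁺ (map⁺ (All.map m≤n⇒m≤1+n K₀≤)) (map⁺ (All.map s≤s (++⁺ K₁≤ (map⁺ K₀≤)))) , F≡K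
  where
  -- F (b ∷ x) = F₀ x + b (F₁ x − F₀ x), where F_b x = F (b ∷ x).
  K₁₋₀ K : List (ℚ × Point _)
  K₁₋₀ = K₁ ++ map (map₁ -_) K₀
  K = map (extend false) K₀ ++ map (extend true) K₁₋₀
  F≡K : ∀ x → T (D (wt x)) → F x ≡ gcomb K x
  F≡K (false ∷ x) Dx = begin
    F (false ∷ x)                ≡⟨ F₀≡K₀ x Dx ⟩
    gcomb K₀ x                   ≡⟨ +-identityʳ _ ⟨
    gcomb K₀ x +ℚ 0ℚ             ≡⟨ cong₂ _+ℚ_ (gcomb-extend-false K₀ false x) (gcomb-extend-true-at-false K₁₋₀ x) ⟨
    _                            ≡⟨ gcomb-++ (map (extend false) K₀) _ (false ∷ x) ⟨
    gcomb K (false ∷ x)          ∎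
    where open ≡-Reasoning
  F≡K (true ∷ x) Dx = begin
    F (true ∷ x)                 ≡⟨ F₁≡K₁ x Dx ⟩
    gcomb K₁ x                   ≡⟨ solve 2 (λ a b → b := a :+ (b :+ (:- a))) refl (gcomb K₀ x) (gcomb K₁ x) ⟩
    gcomb K₀ x +ℚ (gcomb K₁ x +ℚ - gcomb K₀ x)
      ≡⟨ cong (λ s → gcomb K₀ x +ℚ (gcomb K₁ x +ℚ s)) (gcomb-neg K₀ x) ⟨
    gcomb K₀ x +ℚ (gcomb K₁ x +ℚ gcomb (map (map₁ -_) K₀) x)
      ≡⟨ cong (gcomb K₀ x +ℚ_) (gcomb-++ K₁ _ x) ⟨
    gcomb K₀ x +ℚ gcomb (K₁ ++ map (map₁ -_) K₀) x
      ≡⟨ cong₂ _+ℚ_ (gcomb-extend-false K₀ true x) (gcomb-extend-true-at-true K₁₋₀ x) ⟨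
    _                            ≡⟨ gcomb-++ (map (extend false) K₀) _ (true ∷ x) ⟨
    gcomb K (true ∷ x)           ∎
    where open ≡-Reasoning
          open +-*-Solver

semiSym⇒meetInvariant : ∀ {n} {i} (z : Point n) {h : Fun n} → SemiSym i z h → MeetInvariantOn (_≡ᵇ i) z h
semiSym⇒meetInvariant {i = i} z semiSym x x' lx lx' x∩z≡x'∩z =
  semiSym x x' wx≡i wx'≡i (∩-determines-dist z (trans wx≡i (sym wx'≡i)) x∩z≡x'∩z)
  where
  wx≡i : wt x ≡ i
  wx≡i = ≡ᵇ⇒≡ (wt x) i lx
  wx'≡i : wt x' ≡ i
  wx'≡i = ≡ᵇ⇒≡ (wt x') i lx'

semiSym⇒U : ∀ {n} {i} (z : Point n) {h : Fun n} → SemiSym i z h → U i (wt z) h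
semiSym⇒U {i = i} z {h} semiSym with meetInvariant⇒gcomb (_≡ᵇ i) z h (semiSym⇒meetInvariant z semiSym)
... | K , K≤ , h≡K =
  map (λ (c , w) → c , gfun w) K , map⁺ (All.map (λ {p} w≤z → proj₂ p , w≤z , λ _ → refl) K≤) ,
  λ x wx≡i → h≡K x (≡⇒≡ᵇ (wt x) i wx≡i)

⊥gfun⇒⊥U : ∀ {n} {i j} {h : Fun n} →
  (∀ w → wt w ≤ j → ipS i h (gfun w) ≡ 0ℚ) → Perp (ipS i) (U i j) h
⊥gfun⇒⊥U {i = i} {h = h} h⊥gfun = ⊥generators⇒⊥Span (λ x → wt x ≟ i) {f = h} λ where
  g (w , w≤j , g≡gw) →
    trans (ipOn-cong (λ x → wt x ≟ i) {h} (λ _ _ → refl) (λ x _ → g≡gw x)) (h⊥gfun w w≤j)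

U∧⊥gfun⇒V : ∀ {n} {i t} {h : Fun n} →
  U i t h → (∀ w → wt w < t → ipS i h (gfun w) ≡ 0ℚ) → V i t h
U∧⊥gfun⇒V {t = zero} h∈U _ = h∈U
U∧⊥gfun⇒V {t = suc j} {h} h∈U h⊥gfun = h∈U , ⊥gfun⇒⊥U {h = h} (λ w w≤j → h⊥gfun w (s≤s w≤j))

V⇒⊥U : ∀ {n} {i t j} {h : Fun n} → V i t h → j < t → Perp (ipS i) (U i j) h
V⇒⊥U {t = suc t} {h = h} (_ , h⊥U) (s≤s j≤t) = ⊥gfun⇒⊥U {h = h} λ w w≤j →
  h⊥U (gfun w) (generator∈Span (w , ≤-trans w≤j j≤t , λ _ → refl))

SB⇒SemiSym : ∀ {n r i} {z : Point n} {f : Fun n} → i ≤ r → SB r z f → SemiSym i z f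
SB⇒SemiSym i≤r f∈SB x x' wx≡i wx'≡i =
  f∈SB x x' (level⊆B {x = x} i≤r wx≡i) (level⊆B {x = x'} i≤r wx'≡i) (trans wx≡i (sym wx'≡i))

restrict-SB : ∀ {n r i} {z : Point n} {h : Fun n} → SemiSym i z h → SB r z (restrict i h)
restrict-SB {i = i} {h = h} h-semiSym x x' _ _ wx≡wx' dx≡dx' with wt x ≟ i
... | yes wx≡i = begin
  restrict i h x   ≡⟨ restrict-on h wx≡i ⟩
  h x              ≡⟨ h-semiSym x x' wx≡i wx'≡i dx≡dx' ⟩
  h x'             ≡⟨ restrict-on h wx'≡i ⟨
  restrict i h x'  ∎
  where open ≡-Reasoning
        wx'≡i : wt x' ≡ i
        wx'≡i = trans (sym wx≡wx') wx≡i
... | no wx≢i = trans (restrict-off h wx≢i) (sym (restrict-off h (λ wx'≡i → wx≢i (trans wx≡wx' wx'≡i))))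

δ∈SB : ∀ {n r} (x : Point n) → SB r x (δ x)
δ∈SB x _ _ _ _ _ dw≡dw' = cong (λ d → if d ≡ᵇ 0 then 1ℚ else 0ℚ) dw≡dw'

W-vanishes-below : ∀ {n r} {y x : Point n} {f : Fun n} → W r y f → InB r x → wt x < wt y → f x ≡ 0ℚ
W-vanishes-below {r = r} {x = x} {f} (_ , f⊥) x∈B x<y =
  trans (sym (ipOn-δ (λ x → wt x ≤? r) f x∈B)) (f⊥ (δ x) (generator∈Span (x , x∈B , x<y , δ∈SB x)))

0∈W : ∀ {n r} {y : Point n} → W r y (λ _ → 0ℚ)
0∈W {n} {r} =
  (λ _ _ _ _ _ _ → refl) , λ g _ → sumOf-zero (filter (λ x → wt x ≤? r) (allPoints n)) (λ x → *-zeroˡ (g x))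

Wi⊆ZeroOn : ∀ {n r i} {y : Point n} {h : Fun n} → i ≤ r → i < wt y → Wi r y i h → ZeroOn i h
Wi⊆ZeroOn {y = y} i≤r i<y (f , f∈W , h≡f) x wx≡i =
  trans (h≡f x wx≡i) (W-vanishes-below f∈W (level⊆B {x = x} i≤r wx≡i) (subst (_< wt y) (sym wx≡i) i<y))

ZeroOn⊆Wi : ∀ {n r i} {y : Point n} {h : Fun n} → ZeroOn i h → Wi r y i h
ZeroOn⊆Wi h≡0 = (λ _ → 0ℚ) , 0∈W , h≡0

Wi⊆Vyi : ∀ {n r i} {y : Point n} {h : Fun n} → wt y ≤ r → i ≤ r → Wi r y i h → Vyi y i h
Wi⊆Vyi {r = r} {i} {y} {h} y≤r i≤r (f , (f∈SB , f⊥) , h≡f) =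
  U∧⊥gfun⇒V (semiSym⇒U y h-semiSym) h⊥gfun , h-semiSym
  where
  h-semiSym : SemiSym i y h
  h-semiSym x x' wx≡i wx'≡i dx≡dx' =
    trans (h≡f x wx≡i) (trans (SB⇒SemiSym i≤r f∈SB x x' wx≡i wx'≡i dx≡dx') (sym (h≡f x' wx'≡i)))
  h⊥gfun : ∀ w → wt w < wt y → ipS i h (gfun w) ≡ 0ℚ
  h⊥gfun w w<y = begin
    ipS i h (gfun w)               ≡⟨ ipOn-cong (λ x → wt x ≟ i) h≡f (λ _ _ → refl) ⟩
    ipS i f (gfun w)               ≡⟨ ipB-restrictʳ i≤r f (gfun w) ⟨
    ipB r f (restrict i (gfun w))  ≡⟨ f⊥ _ (generator∈Span (w , w∈B , w<y , restrict-SB gw-semiSym)) ⟩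
    0ℚ                             ∎
    where
    open ≡-Reasoning
    w∈B : InB r w
    w∈B = <⇒≤ (<-≤-trans w<y y≤r)
    gw-semiSym : SemiSym i w (gfun w)
    gw-semiSym x x' wx≡i wx'≡i = gfun-by-dist w (trans wx≡i (sym wx'≡i))

Vyi⊆Wi : ∀ {n r i} {y : Point n} {h : Fun n} → i ≤ r → Vyi y i h → Wi r y i h
Vyi⊆Wi {r = r} {i} {y} {h} i≤r (h∈V , h-semiSym) =
  restrict i h , (restrict-SB h-semiSym , restricted⊥) , λ x wx≡i → sym (restrict-on h wx≡i)
  where
  restricted⊥ : Perp (ipB r) (Span (InB r) (λ g → ∃[ z ] (InB r z × wt z < wt y × SB r z g))) (restrict i h)
  restricted⊥ = ⊥generators⇒⊥Span (λ x → wt x ≤? r) {f = restrict i h} λ where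
    g (z , _ , z<y , g∈SB) →
      trans (ipB-restrictˡ i≤r h g) (V⇒⊥U h∈V z<y g (semiSym⇒U z (SB⇒SemiSym i≤r g∈SB)))

lemma2p3 : (n r : ℕ) → 2 * r ≤ n → (y : Point n) → wt y ≤ r → (i : ℕ) → i ≤ r →
    (i < wt y → SameOn i (Wi r y i) (ZeroOn i)) × (wt y ≤ i → SameOn i (Wi r y i) (Vyi y i))
lemma2p3 n r _ y y≤r i i≤r =
  (λ i<y → (λ _ → Wi⊆ZeroOn i≤r i<y) , (λ _ → ZeroOn⊆Wi)) ,
  (λ _ → (λ _ → Wi⊆Vyi y≤r i≤r) , (λ _ → Vyi⊆Wi i≤r))
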